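{- Let $p$ be a positive integer and define $\varphi_p:\{1,\dots,p\}\to\mathbb{Z}$ by $\varphi_p(i)=\min\left(2^{\upsilon_2(i)+1}-1,\ \lfloor p/2\rfloor,\ i-1\right)$. Then $\varphi_p\in F_p$; in particular $F_p$ is nonempty.
   Context: $\upsilon_2(i)$ denotes the $2$-adic valuation of the positive integer $i$ (the exponent of the largest power of $2$ dividing $i$). $F_p$ is the set of functions $f:\{1,\dots,p\}\to\{0,1,\dots,\lfloor p/2\rfloor\}$ such that for every $n\in\{1,\dots,p\}$ and every integer $1\le i\le\lfloor n/2\rfloor$ there exists an integer $k$ with $n-i+1\le k\le n$ and $f(k)\ge i$. -}

module Defs where

open import Data.Nat using (ℕ; zero; suc; _+_; _∸_; _^_; _≤_; _⊓_)
open import Data.Nat.DivMod using (_/_; _%_)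
open import Data.Product using (Σ; _×_; ∃-syntax)

-- 2-adic valuation with fuel: v2-aux fuel n strips factors 2 from n
-- (at most fuel times).  For n ≥ 1, fuel = n suffices, since v2(n) ≤ n.
v2-aux : ℕ → ℕ → ℕ
v2-aux zero    n = zero
v2-aux (suc f) n with n % 2
... | zero  = suc (v2-aux f (n / 2))
... | suc _ = zero

-- υ₂(i) for positive i (value at 0 is irrelevant).
υ₂ : ℕ → ℕ
υ₂ i = v2-aux i i

-- φ_p(i) = min(2^(υ₂(i)+1) − 1, ⌊p/2⌋, i − 1); all terms are ≥ 0 for i ≥ 1.
φ : ℕ → ℕ → ℕ
φ p i = ((2 ^ (υ₂ i + 1)) ∸ 1) ⊓ ((p / 2) ⊓ (i ∸ 1))

InF : ℕ → (ℕ → ℕ) → Set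
InF p f =
  ((n : ℕ) → 1 ≤ n → n ≤ p → f n ≤ p / 2) ×
  ((n : ℕ) → 1 ≤ n → n ≤ p → (i : ℕ) → 1 ≤ i → i ≤ n / 2 →
     ∃[ k ] ((n ∸ i) + 1 ≤ k × k ≤ n × i ≤ f k))

-- Given 1 ≤ i ≤ n/2, let 2^m be the largest power of two not exceeding i
-- and let k be the largest multiple of 2^m not exceeding n.  Then
-- n − i < n − 2^m < k ≤ n, so k lies in the window of length i ending at n,
-- and 2^(υ₂ k + 1) ≥ 2^(m+1) > i.  Finally i ≤ n − i < k and i ≤ n/2 ≤ p/2,
-- so all three terms of the minimum φ p k are at least i.
module Submission where

open import Defs
open import Data.Nat.Base
open import Data.Nat.Properties
open import Data.Nat.DivMod using (_/_; _%_; m*n%n≡0; m*n/n≡m; m%n<n; m≡m%n+[m/n]*n; m/n*n≤m; m≥n⇒m/n>0; /-monoˡ-≤)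
open import Data.Product using (_,_; _×_; ∃-syntax)
open import Relation.Nullary using (yes; no)
open import Relation.Binary.PropositionalEquality

n<2^n : ∀ n → n < 2 ^ n
n<2^n zero    = z<s
n<2^n (suc n) = ≤-<-trans (n<2^n n) (^-monoʳ-< 2 (s≤s (s≤s z≤n)) (n<1+n n))

2^m≤n<2^[1+m] : ∀ n .{{_ : NonZero n}} → ∃[ m ] 2 ^ m ≤ n × n < 2 ^ suc m
2^m≤n<2^[1+m] (suc zero) = 0 , ≤-refl , s≤s (s≤s z≤n)
2^m≤n<2^[1+m] (suc (suc n)) with 2^m≤n<2^[1+m] (suc n)
... | m , lo , hi with 2 + n <? 2 ^ suc m
...   | yes hi′ = m , m≤n⇒m≤1+n lo , hi′
...   | no  ¬hi′ = suc m , ≮⇒≥ ¬hi′ , ≤-<-trans hi (^-monoʳ-< 2 (s≤s (s≤s z≤n)) (n<1+n (suc m)))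

m<n⇒m≤n∸1 : ∀ {m n} → m < n → m ≤ n ∸ 1
m<n⇒m≤n∸1 {m} {n} m<n = subst (m ≤_) (pred[m∸n]≡m∸[1+n] n 0) (<⇒≤pred m<n)

m≤n/2⇒m≤n∸m : ∀ {m n} → m ≤ n / 2 → m ≤ n ∸ m
m≤n/2⇒m≤n∸m {m} {n} m≤n/2 = m+n≤o⇒m≤o∸n m (begin
  m + m      ≡⟨ cong (m +_) (sym (+-identityʳ m)) ⟩
  2 * m      ≡⟨ *-comm 2 m ⟩
  m * 2      ≤⟨ *-monoˡ-≤ 2 m≤n/2 ⟩
  n / 2 * 2  ≤⟨ m/n*n≤m n 2 ⟩
  n          ∎)
  where open ≤-Reasoning

m<m/n*n+n : ∀ m n .{{_ : NonZero n}} → m < m / n * n + n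
m<m/n*n+n m n = begin-strict
  m                  ≡⟨ m≡m%n+[m/n]*n m n ⟩
  m % n + m / n * n  <⟨ +-monoˡ-< (m / n * n) (m%n<n m n) ⟩
  n + m / n * n      ≡⟨ +-comm n (m / n * n) ⟩
  m / n * n + n      ∎
  where open ≤-Reasoning

v2-aux-*2 : ∀ f x → v2-aux (suc f) (x * 2) ≡ suc (v2-aux f x)
v2-aux-*2 f x with (x * 2) % 2 | m*n%n≡0 x 2
... | .0 | refl = cong (λ y → suc (v2-aux f y)) (m*n/n≡m x 2)

m≤v2-aux[q*2^m] : ∀ q {m f} → m ≤ f → m ≤ v2-aux f (q * 2 ^ m)
m≤v2-aux[q*2^m] q {zero}  _         = z≤n
m≤v2-aux[q*2^m] q {suc m} {suc f} (s≤s m≤f) = begin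
  suc m                            ≤⟨ s≤s (m≤v2-aux[q*2^m] q m≤f) ⟩
  suc (v2-aux f (q * 2 ^ m))       ≡⟨ sym (v2-aux-*2 f (q * 2 ^ m)) ⟩
  v2-aux (suc f) (q * 2 ^ m * 2)   ≡⟨ cong (v2-aux (suc f)) q*2^m*2≡q*2^[1+m] ⟩
  v2-aux (suc f) (q * 2 ^ suc m)   ∎
  where
  open ≤-Reasoning
  q*2^m*2≡q*2^[1+m] : q * 2 ^ m * 2 ≡ q * 2 ^ suc m
  q*2^m*2≡q*2^[1+m] = trans (*-assoc q (2 ^ m) 2) (cong (q *_) (*-comm (2 ^ m) 2))

m≤υ₂[q*2^m] : ∀ q m .{{_ : NonZero q}} → m ≤ υ₂ (q * 2 ^ m)
m≤υ₂[q*2^m] q m = m≤v2-aux[q*2^m] q (≤-trans (<⇒≤ (n<2^n m)) (m≤n*m (2 ^ m) q))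

window-witness : ∀ n i .{{_ : NonZero i}} → i ≤ n / 2 →
  ∃[ k ] n ∸ i + 1 ≤ k × k ≤ n × i < k × i < 2 ^ (υ₂ k + 1)
window-witness n i i≤n/2 with 2^m≤n<2^[1+m] i
... | m , 2^m≤i , i<2^[1+m] = k , lower , m/n*n≤m n t , i<k , i<2^[υ₂k+1]
  where
  t = 2 ^ m
  instance
    t≢0 : NonZero t
    t≢0 = m^n≢0 2 m
  i≤n∸i : i ≤ n ∸ i
  i≤n∸i = m≤n/2⇒m≤n∸m i≤n/2
  i≤n : i ≤ n
  i≤n = ≤-trans i≤n∸i (m∸n≤m n i)
  q = n / t
  instance
    q≢0 : NonZero q
    q≢0 = >-nonZero (m≥n⇒m/n>0 (≤-trans 2^m≤i i≤n))
  k = q * t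
  n<i+k : n < i + k
  n<i+k = <-≤-trans (m<m/n*n+n n t) (≤-trans (+-monoʳ-≤ k 2^m≤i) (≤-reflexive (+-comm k i)))
  n∸i<k : n ∸ i < k
  n∸i<k = subst (n ∸ i <_) (m+n∸m≡n i k) (∸-monoˡ-< n<i+k i≤n)
  lower : n ∸ i + 1 ≤ k
  lower = subst (_≤ k) (+-comm 1 (n ∸ i)) n∸i<k
  i<k : i < k
  i<k = ≤-<-trans i≤n∸i n∸i<k
  i<2^[υ₂k+1] : i < 2 ^ (υ₂ k + 1)
  i<2^[υ₂k+1] = <-≤-trans i<2^[1+m]
    (^-monoʳ-≤ 2 (subst (suc m ≤_) (+-comm 1 (υ₂ k)) (s≤s (m≤υ₂[q*2^m] q m))))

lemma6 : (p : ℕ) → 1 ≤ p → InF p (φ p)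
lemma6 p _ = bounded , covering
  where
  bounded : (n : ℕ) → 1 ≤ n → n ≤ p → φ p n ≤ p / 2
  bounded n _ _ = ≤-trans (m⊓n≤n _ _) (m⊓n≤m _ _)

  covering : (n : ℕ) → 1 ≤ n → n ≤ p → (i : ℕ) → 1 ≤ i → i ≤ n / 2 →
    ∃[ k ] ((n ∸ i) + 1 ≤ k × k ≤ n × i ≤ φ p k)
  covering n _ n≤p i 1≤i i≤n/2
    with window-witness n i {{>-nonZero 1≤i}} i≤n/2
  ... | k , lower , k≤n , i<k , i<2^[υ₂k+1] =
    k , lower , k≤n ,
    ⊓-glb (m<n⇒m≤n∸1 i<2^[υ₂k+1]) (⊓-glb (≤-trans i≤n/2 (/-monoˡ-≤ 2 n≤p)) (m<n⇒m≤n∸1 i<k))
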